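{- Let $E=\mathbb{Q}(\sqrt\Delta)$ with $\Delta>0$ squarefree. Let $p$ be an odd prime with $(p)=\mathfrak p\mathfrak p'$ split in $E$, and let $a\in\mathbb{Z}$ be prime to $p$ and congruent to some unit of $\mathcal O_E^\times$ modulo $\mathfrak p$. Then there exist $\beta\in E\setminus\mathbb{Q}$ depending only on $p$ and $\Delta$, and a $\beta$-unital matrix $M(a)\in\mathrm{GL}_2(\mathbb{Z})$ of the form $$M(a)=\begin{pmatrix}a+ps&*\\ pt&*\end{pmatrix}$$ with $s,t\in\mathbb{Z}$. Moreover, for $\lambda=e+f\sqrt\Delta\in\mathcal O_E^\times$ with $\lambda\equiv a\pmod{\mathfrak p}$, $M(a)$ can be chosen so that its determinant equals the norm of $\lambda$, $t=2f$, and $a+ps=x_0f+e$ for some integer $x_0$, which is odd if $e$ and $f$ are both half-integers.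
   Context: A matrix $\gamma\in\mathrm{GL}_2(\mathbb{Z})$ is $\beta$-unital (for $\beta\in E\setminus\mathbb{Q}$) if $\gamma(\beta:1)=(\beta:1)$ under the fractional linear action on $\mathbb{P}^1(E)$. Elements of $\mathcal O_E$ are written $e+f\sqrt\Delta$ with $e,f\in\mathbb{Z}$, or $e,f$ both half-integers when $\Delta\equiv1\bmod4$. -}

module Defs where

open import Data.Nat as ℕ using (ℕ)
open import Data.Nat.Divisibility as ℕD using ()
open import Data.Integer as ℤ using (ℤ; +_)
open import Data.Integer.Divisibility as ℤD using ()
open import Data.Rational as ℚ using (ℚ; _/_; 0ℚ; 1ℚ)
open import Data.Product using (Σ; ∃; ∃-syntax; _×_; _,_)
open import Data.Sum using (_⊎_)
open import Relation.Nullary using (¬_)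
open import Relation.Binary.PropositionalEquality using (_≡_; _≢_)

ℤ→ℚ : ℤ → ℚ
ℤ→ℚ z = z / 1

ℕ→ℚ : ℕ → ℚ
ℕ→ℚ n = ℤ→ℚ (+ n)

SquareFree : ℕ → Set
SquareFree n = ∀ m → (m ℕ.* m) ℕD.∣ n → m ≡ 1

OddInt : ℤ → Set
OddInt x = ¬ (+ 2 ℤD.∣ x)

-- The quadratic field E = ℚ(√Δ): elements re + im √Δ with re im ∈ ℚ.
-- (Δ squarefree and ≠ 1, so the representation is unique.)

record E : Set where
  constructor _+_√Δ
  field
    re : ℚ
    im : ℚ
open E public

embℤ : ℤ → E
embℤ z = ℤ→ℚ z + 0ℚ √Δ

√Δ : E
√Δ = 0ℚ + 1ℚ √Δ

_+E_ : E → E → E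
(a + b √Δ) +E (c + d √Δ) = (a ℚ.+ c) + (b ℚ.+ d) √Δ

_-E_ : E → E → E
(a + b √Δ) -E (c + d √Δ) = (a ℚ.- c) + (b ℚ.- d) √Δ

mulE : ℕ → E → E → E
mulE Δ (a + b √Δ) (c + d √Δ) =
  (a ℚ.* c ℚ.+ ℕ→ℚ Δ ℚ.* (b ℚ.* d)) + (a ℚ.* d ℚ.+ b ℚ.* c) √Δ

normE : ℕ → E → ℚ
normE Δ (a + b √Δ) = a ℚ.* a ℚ.- ℕ→ℚ Δ ℚ.* (b ℚ.* b)

NotRational : E → Set
NotRational β = im β ≢ 0ℚ

HalfInt : ℚ → Set
HalfInt q = ∃[ k ] q ≡ (k ℤ.* + 2 ℤ.+ + 1) / 2

InOE : ℕ → E → Set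
InOE Δ z =
  (∃[ e ] ∃[ f ] z ≡ ℤ→ℚ e + ℤ→ℚ f √Δ)
  ⊎ ((Δ ℕ.% 4 ≡ 1) × HalfInt (re z) × HalfInt (im z))

IsUnit : ℕ → E → Set
IsUnit Δ z = InOE Δ z × (∃[ w ] InOE Δ w × mulE Δ z w ≡ embℤ (+ 1))

-- the prime 𝔭 = (p, √Δ - r) of 𝒪_E above p (r² ≡ Δ mod p):
-- membership z ∈ 𝔭  iff  z = p·x + (√Δ - r)·y with x, y ∈ 𝒪_E
InPrime : ℕ → ℕ → ℤ → E → Set
InPrime Δ p r z =
  ∃[ x ] ∃[ y ] InOE Δ x × InOE Δ y ×
    z ≡ mulE Δ (embℤ (+ p)) x +E mulE Δ (√Δ -E embℤ r) y

CongModPrime : ℕ → ℕ → ℤ → E → ℤ → Set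
CongModPrime Δ p r u a = InPrime Δ p r (u -E embℤ a)

record Mat2 : Set where
  constructor mat
  field
    m11 m12 m21 m22 : ℤ
open Mat2 public

det : Mat2 → ℤ
det M = m11 M ℤ.* m22 M ℤ.- m12 M ℤ.* m21 M

InGL2ℤ : Mat2 → Set
InGL2ℤ M = det M ≡ + 1 ⊎ det M ≡ ℤ.- (+ 1)

NonZeroPair : E × E → Set
NonZeroPair (x , y) = ¬ (x ≡ embℤ (+ 0) × y ≡ embℤ (+ 0))

SameP1 : ℕ → E × E → E × E → Set
SameP1 Δ (x , y) (x' , y') =
  NonZeroPair (x , y) × NonZeroPair (x' , y') × mulE Δ x y' ≡ mulE Δ x' y

act : ℕ → Mat2 → E × E → E × E
act Δ M (x , y) =
  (mulE Δ (embℤ (m11 M)) x +E mulE Δ (embℤ (m12 M)) y)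
  , (mulE Δ (embℤ (m21 M)) x +E mulE Δ (embℤ (m22 M)) y)

BetaUnital : ℕ → E → Mat2 → Set
BetaUnital Δ β M = SameP1 Δ (act Δ M (β , embℤ (+ 1))) (β , embℤ (+ 1))

-- Put c = r + p(Δ − r): then c ≡ r (mod p) and c ≡ Δ (mod 2), so c² ≡ Δ (mod 2p), and
-- c² ≡ Δ (mod 4p) with c odd when Δ ≡ 1 (mod 4). Take β = (c + √Δ)/2p. For u = e + f√Δ the
-- matrix of multiplication by u in the basis (β, 1) of E is
--   M = [[e + fc, f(Δ − c²)/2p], [2pf, e − fc]],
-- so M fixes (β : 1) and det M = N(u), which is ±1 for a unit. Its entries are integers by
-- the congruences on c (when e, f are half-integers, e + fc ∈ ℤ because c is odd). Reducing
-- u ≡ a (mod 𝔭) along √Δ ↦ r ≡ c gives e + fc ≡ a (mod p), whence m₁₁ = a + ps, t = 2f and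
-- x₀ = c.
module Submission where

open import Defs
open import Data.Nat as ℕ using (ℕ; suc; zero)
open import Data.Nat.DivMod using (_%_; _/_; m≡m%n+[m/n]*n; m%n<n)
open import Data.Nat.Divisibility as ℕD using ()
open import Data.Nat.Primality using (Prime; prime⇒nonZero)
import Data.Nat.Properties as ℕP
open import Data.Nat.Coprimality as Cop using ()
open import Data.Integer as ℤ using (ℤ; +_; -[1+_])
import Data.Integer.Properties as ℤP
open import Data.Integer.DivMod using (a≡a%n+[a/n]*n; n%d<d)
open import Data.Integer.Divisibility as ℤD using ()
open import Data.Integer.Divisibility.Signed
import Data.Integer.Tactic.RingSolver as ℤSolver
open import Data.Rational as ℚ using (ℚ; mkℚ; 0ℚ; 1ℚ)
import Data.Rational.Properties as ℚP
open import Data.Rational.Solver using (module +-*-Solver)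
open import Data.List using (_∷_; [])
open import Data.Product using (Σ; ∃-syntax; _×_; _,_; proj₁; proj₂)
open import Data.Sum using (_⊎_; inj₁; inj₂)
open import Data.Empty using (⊥-elim)
open import Relation.Nullary using (¬_)
open import Relation.Binary.PropositionalEquality
open +-*-Solver

∣*-cancel-invertible : ∀ {d n y} u v → n ℤ.* u ≡ + 1 ℤ.+ d ℤ.* v → d ∣ n ℤ.* y → d ∣ y
∣*-cancel-invertible {d} {n} {y} u v nu≡1+dv d∣ny =
  subst (d ∣_) y≡ (∣m∣n⇒∣m-n (∣n⇒∣m*n u d∣ny) (∣n⇒∣m*n (v ℤ.* y) ∣-refl))
  where
  open ≡-Reasoning
  y≡ : u ℤ.* (n ℤ.* y) ℤ.- v ℤ.* y ℤ.* d ≡ y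
  y≡ = begin
    u ℤ.* (n ℤ.* y) ℤ.- v ℤ.* y ℤ.* d   ≡⟨ ℤSolver.solve (u ∷ n ∷ y ∷ v ∷ d ∷ []) ⟩
    n ℤ.* u ℤ.* y ℤ.- d ℤ.* v ℤ.* y     ≡⟨ cong (λ z → z ℤ.* y ℤ.- d ℤ.* v ℤ.* y) nu≡1+dv ⟩
    (+ 1 ℤ.+ d ℤ.* v) ℤ.* y ℤ.- d ℤ.* v ℤ.* y ≡⟨ ℤSolver.solve (y ∷ v ∷ d ∷ []) ⟩
    y ∎

∣∧∣⇒*∣ : ∀ {d n x} u v → n ℤ.* u ≡ + 1 ℤ.+ d ℤ.* v → d ∣ x → n ∣ x → d ℤ.* n ∣ x
∣∧∣⇒*∣ {d} {n} {x} u v nu≡1+dv d∣x (divides k x≡kn) with ∣*-cancel-invertible {d} {n} {k} u v nu≡1+dv d∣nk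
  where
  d∣nk : d ∣ n ℤ.* k
  d∣nk = subst (d ∣_) (trans x≡kn (ℤP.*-comm k n)) d∣x
... | divides j k≡jd = divides j (begin
  x             ≡⟨ x≡kn ⟩
  k ℤ.* n       ≡⟨ cong (ℤ._* n) k≡jd ⟩
  j ℤ.* d ℤ.* n ≡⟨ ℤP.*-assoc j d n ⟩
  j ℤ.* (d ℤ.* n) ∎)
  where open ≡-Reasoning

even⊎odd : ∀ n → ∃[ m ] (n ≡ m ℤ.* + 2 ⊎ n ≡ m ℤ.* + 2 ℤ.+ + 1)
even⊎odd n with n ℤ.% + 2 | a≡a%n+[a/n]*n n (+ 2) | n%d<d n (+ 2)
... | 0 | n≡ | _ = n ℤ./ + 2 , inj₁ (trans n≡ (ℤP.+-identityˡ (n ℤ./ + 2 ℤ.* + 2)))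
... | 1 | n≡ | _ = n ℤ./ + 2 , inj₂ (trans n≡ (ℤP.+-comm (+ 1) (n ℤ./ + 2 ℤ.* + 2)))
... | suc (suc _) | _ | ℕ.s≤s (ℕ.s≤s ())

2∣n*n-n : ∀ n → + 2 ∣ n ℤ.* n ℤ.- n
2∣n*n-n n with even⊎odd n
... | m , inj₁ refl = divides (m ℤ.* m ℤ.* + 2 ℤ.- m) (even-case m)
  where
  even-case : ∀ m → m ℤ.* + 2 ℤ.* (m ℤ.* + 2) ℤ.- m ℤ.* + 2 ≡ (m ℤ.* m ℤ.* + 2 ℤ.- m) ℤ.* + 2
  even-case = ℤSolver.solve-∀
... | m , inj₂ refl = divides (m ℤ.* m ℤ.* + 2 ℤ.+ m) (odd-case m)
  where
  odd-case : ∀ m → (m ℤ.* + 2 ℤ.+ + 1) ℤ.* (m ℤ.* + 2 ℤ.+ + 1) ℤ.- (m ℤ.* + 2 ℤ.+ + 1)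
                   ≡ (m ℤ.* m ℤ.* + 2 ℤ.+ m) ℤ.* + 2
  odd-case = ℤSolver.solve-∀

∣m-n⇒m≡n+k*q : ∀ {k m n} (k∣m-n : k ∣ m ℤ.- n) → m ≡ n ℤ.+ k ℤ.* quotient k∣m-n
∣m-n⇒m≡n+k*q {k} {m} {n} (divides q m-n≡qk) = begin
  m                 ≡⟨ recentre m n ⟩
  n ℤ.+ (m ℤ.- n)   ≡⟨ cong (λ x → n ℤ.+ x) (trans m-n≡qk (ℤP.*-comm q k)) ⟩
  n ℤ.+ k ℤ.* q     ∎
  where
  open ≡-Reasoning
  recentre : ∀ m n → m ≡ n ℤ.+ (m ℤ.- n)
  recentre = ℤSolver.solve-∀

odd⇒≡2Q+1 : ∀ {p} → ¬ (2 ℕD.∣ p) → + p ≡ + (p / 2) ℤ.* + 2 ℤ.+ + 1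
odd⇒≡2Q+1 {p} p-odd with p % 2 | m≡m%n+[m/n]*n p 2 | m%n<n p 2
... | 0 | p≡ | _ = ⊥-elim (p-odd (ℕD.divides (p / 2) p≡))
... | 1 | p≡ | _ = begin
  + p                         ≡⟨ cong +_ p≡ ⟩
  + (1 ℕ.+ p / 2 ℕ.* 2)       ≡⟨ ℤP.pos-+ 1 (p / 2 ℕ.* 2) ⟩
  + 1 ℤ.+ + (p / 2 ℕ.* 2)     ≡⟨ ℤP.+-comm (+ 1) (+ (p / 2 ℕ.* 2)) ⟩
  + (p / 2 ℕ.* 2) ℤ.+ + 1     ≡⟨ cong (ℤ._+ + 1) (ℤP.pos-* (p / 2) 2) ⟩
  + (p / 2) ℤ.* + 2 ℤ.+ + 1   ∎
  where open ≡-Reasoning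
... | suc (suc _) | _ | ℕ.s≤s (ℕ.s≤s ())

record SqrtMod (D P c : ℤ) : Set where
  field
    mod-2P : + 2 ℤ.* P ∣ D ℤ.- c ℤ.* c
    mod-4P : ∀ w → D ≡ w ℤ.* + 4 ℤ.+ + 1 →
             (∃[ j ] c ≡ j ℤ.* + 2 ℤ.+ + 1) × (+ 4 ℤ.* P ∣ D ℤ.- c ℤ.* c)

-- Lifts a square root r of D modulo P to one modulo 2P (for odd P).
liftRoot : ℤ → ℤ → ℤ → ℤ
liftRoot P D r = r ℤ.+ P ℤ.* (D ℤ.- r)

liftRoot≡r : ∀ P D r → P ∣ liftRoot P D r ℤ.- r
liftRoot≡r P D r = divides (D ℤ.- r) (split P D r)
  where
  split : ∀ P D r → r ℤ.+ P ℤ.* (D ℤ.- r) ℤ.- r ≡ (D ℤ.- r) ℤ.* P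
  split = ℤSolver.solve-∀

liftRoot²≡D : ∀ {P D r} → P ∣ r ℤ.* r ℤ.- D → P ∣ D ℤ.- liftRoot P D r ℤ.* liftRoot P D r
liftRoot²≡D {P} {D} {r} P∣r²-D = subst (P ∣_) (sym (split P D r))
  (∣m∣n⇒∣m+n (∣m⇒∣-m P∣r²-D) (∣m⇒∣m*n (ℤ.- ((D ℤ.- r) ℤ.* (liftRoot P D r ℤ.+ r))) (∣-refl {P})))
  where
  split : ∀ P D r → let c = r ℤ.+ P ℤ.* (D ℤ.- r) in
    D ℤ.- c ℤ.* c ≡ ℤ.- (r ℤ.* r ℤ.- D) ℤ.+ P ℤ.* (ℤ.- ((D ℤ.- r) ℤ.* (c ℤ.+ r)))
  split = ℤSolver.solve-∀

liftRoot²≡D-mod-2 : ∀ {P D} r Q → P ≡ Q ℤ.* + 2 ℤ.+ + 1 → + 2 ∣ D ℤ.- liftRoot P D r ℤ.* liftRoot P D r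
liftRoot²≡D-mod-2 {D = D} r Q refl = subst (+ 2 ∣_) (sym (split Q D r))
  (∣m∣n⇒∣m+n (∣m⇒∣-m (2∣n*n-n c)) (∣m⇒∣m*n (ℤ.- (Q ℤ.* (D ℤ.- r))) (∣-refl {+ 2})))
  where
  c : ℤ
  c = liftRoot (Q ℤ.* + 2 ℤ.+ + 1) D r
  split : ∀ Q D r → let c = r ℤ.+ (Q ℤ.* + 2 ℤ.+ + 1) ℤ.* (D ℤ.- r) in
    D ℤ.- c ℤ.* c ≡ ℤ.- (c ℤ.* c ℤ.- c) ℤ.+ + 2 ℤ.* (ℤ.- (Q ℤ.* (D ℤ.- r)))
  split = ℤSolver.solve-∀

liftRoot²≡D-mod-4 : ∀ {P D} r Q w → P ≡ Q ℤ.* + 2 ℤ.+ + 1 → D ≡ w ℤ.* + 4 ℤ.+ + 1 →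
  let c = liftRoot P D r in (∃[ j ] c ≡ j ℤ.* + 2 ℤ.+ + 1) × (+ 4 ∣ D ℤ.- c ℤ.* c)
liftRoot²≡D-mod-4 r Q w refl refl = (j , c-odd Q w r) , divides (w ℤ.- j ℤ.* j ℤ.- j) (split Q w r)
  where
  j : ℤ
  j = w ℤ.* + 2 ℤ.+ Q ℤ.* (w ℤ.* + 4 ℤ.+ + 1 ℤ.- r)
  c-odd : ∀ Q w r → let D = w ℤ.* + 4 ℤ.+ + 1 in
    r ℤ.+ (Q ℤ.* + 2 ℤ.+ + 1) ℤ.* (D ℤ.- r) ≡ (w ℤ.* + 2 ℤ.+ Q ℤ.* (D ℤ.- r)) ℤ.* + 2 ℤ.+ + 1
  c-odd = ℤSolver.solve-∀
  split : ∀ Q w r →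
    let D = w ℤ.* + 4 ℤ.+ + 1
        c = r ℤ.+ (Q ℤ.* + 2 ℤ.+ + 1) ℤ.* (D ℤ.- r)
        j = w ℤ.* + 2 ℤ.+ Q ℤ.* (D ℤ.- r)
    in D ℤ.- c ℤ.* c ≡ (w ℤ.- j ℤ.* j ℤ.- j) ℤ.* + 4
  split = ℤSolver.solve-∀

liftRoot-sqrtMod : ∀ {P D r} Q → P ≡ Q ℤ.* + 2 ℤ.+ + 1 → P ∣ r ℤ.* r ℤ.- D →
                   SqrtMod D P (liftRoot P D r)
liftRoot-sqrtMod {P} {D} {r} Q P≡2Q+1 P∣r²-D = record
  { mod-2P = ∣∧∣⇒*∣ {+ 2} {P} (+ 1) Q P*1≡1+2Q (liftRoot²≡D-mod-2 {D = D} r Q P≡2Q+1) P∣D-c²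
  ; mod-4P = λ w D≡4w+1 → let (odd , 4∣D-c²) = liftRoot²≡D-mod-4 {P} {D} r Q w P≡2Q+1 D≡4w+1 in
      odd , ∣∧∣⇒*∣ {+ 4} {P} P (Q ℤ.* (Q ℤ.+ + 1)) P*P≡1+4Q[Q+1] 4∣D-c² P∣D-c²
  }
  where
  P∣D-c² : P ∣ D ℤ.- liftRoot P D r ℤ.* liftRoot P D r
  P∣D-c² = liftRoot²≡D {P} {D} {r} P∣r²-D
  P*1≡1+2Q : P ℤ.* + 1 ≡ + 1 ℤ.+ + 2 ℤ.* Q
  P*1≡1+2Q = trans (cong (ℤ._* + 1) P≡2Q+1) (ℤSolver.solve (Q ∷ []))
  P*P≡1+4Q[Q+1] : P ℤ.* P ≡ + 1 ℤ.+ + 4 ℤ.* (Q ℤ.* (Q ℤ.+ + 1))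
  P*P≡1+4Q[Q+1] = trans (cong (λ P → P ℤ.* P) P≡2Q+1) (ℤSolver.solve (Q ∷ []))

ℤ→ℚ-mkℚ : ∀ z → ℤ→ℚ z ≡ mkℚ z 0 (Cop.sym (Cop.1-coprimeTo ℤ.∣ z ∣))
ℤ→ℚ-mkℚ z = ℚP.↥p/↧p≡p (mkℚ z 0 _)

ℤ→ℚ-injective : ∀ {x y} → ℤ→ℚ x ≡ ℤ→ℚ y → x ≡ y
ℤ→ℚ-injective {x} {y} eq = cong ℚ.numerator (trans (sym (ℤ→ℚ-mkℚ x)) (trans eq (ℤ→ℚ-mkℚ y)))

ℤ→ℚ-homo-+ : ∀ x y → ℤ→ℚ (x ℤ.+ y) ≡ ℤ→ℚ x ℚ.+ ℤ→ℚ y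
ℤ→ℚ-homo-+ x y rewrite ℤ→ℚ-mkℚ x | ℤ→ℚ-mkℚ y =
  cong (ℚ._/ 1) (sym (cong₂ ℤ._+_ (ℤP.*-identityʳ x) (ℤP.*-identityʳ y)))

ℤ→ℚ-homo-* : ∀ x y → ℤ→ℚ (x ℤ.* y) ≡ ℤ→ℚ x ℚ.* ℤ→ℚ y
ℤ→ℚ-homo-* x y rewrite ℤ→ℚ-mkℚ x | ℤ→ℚ-mkℚ y = refl

ℤ→ℚ-homo‿- : ∀ x → ℤ→ℚ (ℤ.- x) ≡ ℚ.- ℤ→ℚ x
ℤ→ℚ-homo‿- x rewrite ℤ→ℚ-mkℚ x | ℤ→ℚ-mkℚ (ℤ.- x) with x
... | + zero   = refl
... | + suc n  = refl
... | -[1+ n ] = refl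

ℤ→ℚ-homo-− : ∀ x y → ℤ→ℚ (x ℤ.- y) ≡ ℤ→ℚ x ℚ.- ℤ→ℚ y
ℤ→ℚ-homo-− x y = trans (ℤ→ℚ-homo-+ x (ℤ.- y)) (cong (ℤ→ℚ x ℚ.+_) (ℤ→ℚ-homo‿- y))

two : ℚ
two = ℤ→ℚ (+ 2)

ℤ→ℚ≡two*/2 : ∀ z → ℤ→ℚ z ≡ two ℚ.* (z ℚ./ 2)
ℤ→ℚ≡two*/2 z = begin
  ℤ→ℚ z                        ≡⟨ solve 1 (λ x → x := con two :* (x :* con half)) refl (ℤ→ℚ z) ⟩
  two ℚ.* (ℤ→ℚ z ℚ.* half)     ≡⟨ cong (two ℚ.*_) /2≡*half ⟩
  two ℚ.* (z ℚ./ 2)              ∎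
  where
  open ≡-Reasoning
  half : ℚ
  half = + 1 ℚ./ 2
  /2≡*half : ℤ→ℚ z ℚ.* half ≡ z ℚ./ 2
  /2≡*half rewrite ℤ→ℚ-mkℚ z = cong (ℚ._/ 2) (ℤP.*-identityʳ z)

*-cancelˡ-≡ : ∀ r {p q} .{{_ : ℚ.NonZero r}} → r ℚ.* p ≡ r ℚ.* q → p ≡ q
*-cancelˡ-≡ r {p} {q} rp≡rq = begin
  p                       ≡⟨ sym (ℚP.*-identityˡ p) ⟩
  1ℚ ℚ.* p                ≡⟨ cong (ℚ._* p) (sym (ℚP.*-inverseˡ r)) ⟩
  ℚ.1/ r ℚ.* r ℚ.* p      ≡⟨ ℚP.*-assoc (ℚ.1/ r) r p ⟩
  ℚ.1/ r ℚ.* (r ℚ.* p)    ≡⟨ cong (ℚ.1/ r ℚ.*_) rp≡rq ⟩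
  ℚ.1/ r ℚ.* (r ℚ.* q)    ≡⟨ sym (ℚP.*-assoc (ℚ.1/ r) r q) ⟩
  ℚ.1/ r ℚ.* r ℚ.* q      ≡⟨ cong (ℚ._* q) (ℚP.*-inverseˡ r) ⟩
  1ℚ ℚ.* q                ≡⟨ ℚP.*-identityˡ q ⟩
  q                       ∎
  where open ≡-Reasoning

record DoubledCoords (x : E) (X₁ X₂ : ℤ) : Set where
  constructor doubled
  field
    re-doubled : ℤ→ℚ X₁ ≡ two ℚ.* re x
    im-doubled : ℤ→ℚ X₂ ≡ two ℚ.* im x

doubled-unique : ∀ {x X₁ X₂ Y₁ Y₂} → DoubledCoords x X₁ X₂ → DoubledCoords x Y₁ Y₂ → X₁ ≡ Y₁ × X₂ ≡ Y₂
doubled-unique (doubled X₁≡ X₂≡) (doubled Y₁≡ Y₂≡) =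
  ℤ→ℚ-injective (trans X₁≡ (sym Y₁≡)) , ℤ→ℚ-injective (trans X₂≡ (sym Y₂≡))

doubled-embℤ : ∀ a → DoubledCoords (embℤ a) (+ 2 ℤ.* a) (+ 0)
doubled-embℤ a = doubled (ℤ→ℚ-homo-* (+ 2) a) refl

doubled-+E : ∀ {x y X₁ X₂ Y₁ Y₂} → DoubledCoords x X₁ X₂ → DoubledCoords y Y₁ Y₂ →
             DoubledCoords (x +E y) (X₁ ℤ.+ Y₁) (X₂ ℤ.+ Y₂)
doubled-+E {x} {y} {X₁} {X₂} {Y₁} {Y₂} (doubled X₁≡ X₂≡) (doubled Y₁≡ Y₂≡) =
  doubled (coord {re x} {re y} {X₁} {Y₁} X₁≡ Y₁≡) (coord {im x} {im y} {X₂} {Y₂} X₂≡ Y₂≡)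
  where
  coord : ∀ {a b A B} → ℤ→ℚ A ≡ two ℚ.* a → ℤ→ℚ B ≡ two ℚ.* b → ℤ→ℚ (A ℤ.+ B) ≡ two ℚ.* (a ℚ.+ b)
  coord {a} {b} {A} {B} A≡ B≡ =
    trans (ℤ→ℚ-homo-+ A B) (trans (cong₂ ℚ._+_ A≡ B≡) (sym (ℚP.*-distribˡ-+ two a b)))

doubled--E : ∀ {x y X₁ X₂ Y₁ Y₂} → DoubledCoords x X₁ X₂ → DoubledCoords y Y₁ Y₂ →
             DoubledCoords (x -E y) (X₁ ℤ.- Y₁) (X₂ ℤ.- Y₂)
doubled--E {x} {y} {X₁} {X₂} {Y₁} {Y₂} (doubled X₁≡ X₂≡) (doubled Y₁≡ Y₂≡) =
  doubled (coord {re x} {re y} {X₁} {Y₁} X₁≡ Y₁≡) (coord {im x} {im y} {X₂} {Y₂} X₂≡ Y₂≡)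
  where
  coord : ∀ {a b A B} → ℤ→ℚ A ≡ two ℚ.* a → ℤ→ℚ B ≡ two ℚ.* b → ℤ→ℚ (A ℤ.- B) ≡ two ℚ.* (a ℚ.- b)
  coord {a} {b} {A} {B} A≡ B≡ =
    trans (ℤ→ℚ-homo-− A B) (trans (cong₂ ℚ._-_ A≡ B≡)
      (solve 3 (λ t a b → t :* a :- t :* b := t :* (a :- b)) refl two a b))

doubled-mulE : ∀ {Δ z x i j X₁ X₂} → re z ≡ ℤ→ℚ i → im z ≡ ℤ→ℚ j → DoubledCoords x X₁ X₂ →
  DoubledCoords (mulE Δ z x) (i ℤ.* X₁ ℤ.+ + Δ ℤ.* (j ℤ.* X₂)) (i ℤ.* X₂ ℤ.+ j ℤ.* X₁)
doubled-mulE {Δ} {z} {x} {i} {j} {X₁} {X₂} re≡ im≡ (doubled X₁≡ X₂≡) = doubled re-coord im-coord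
  where
  open ≡-Reasoning
  D : ℚ
  D = ℕ→ℚ Δ
  re-coord : ℤ→ℚ (i ℤ.* X₁ ℤ.+ + Δ ℤ.* (j ℤ.* X₂)) ≡ two ℚ.* re (mulE Δ z x)
  re-coord = begin
    ℤ→ℚ (i ℤ.* X₁ ℤ.+ + Δ ℤ.* (j ℤ.* X₂))
      ≡⟨ trans (ℤ→ℚ-homo-+ (i ℤ.* X₁) (+ Δ ℤ.* (j ℤ.* X₂))) (cong₂ ℚ._+_ (ℤ→ℚ-homo-* i X₁)
           (trans (ℤ→ℚ-homo-* (+ Δ) (j ℤ.* X₂)) (cong (D ℚ.*_) (ℤ→ℚ-homo-* j X₂)))) ⟩
    ℤ→ℚ i ℚ.* ℤ→ℚ X₁ ℚ.+ D ℚ.* (ℤ→ℚ j ℚ.* ℤ→ℚ X₂)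
      ≡⟨ cong₂ (λ s t → s ℚ.+ D ℚ.* t) (cong₂ ℚ._*_ (sym re≡) X₁≡) (cong₂ ℚ._*_ (sym im≡) X₂≡) ⟩
    re z ℚ.* (two ℚ.* re x) ℚ.+ D ℚ.* (im z ℚ.* (two ℚ.* im x))
      ≡⟨ solve 5 (λ a b c d D → a :* (con two :* c) :+ D :* (b :* (con two :* d))
                              := con two :* (a :* c :+ D :* (b :* d))) refl (re z) (im z) (re x) (im x) D ⟩
    two ℚ.* re (mulE Δ z x) ∎
  im-coord : ℤ→ℚ (i ℤ.* X₂ ℤ.+ j ℤ.* X₁) ≡ two ℚ.* im (mulE Δ z x)
  im-coord = begin
    ℤ→ℚ (i ℤ.* X₂ ℤ.+ j ℤ.* X₁)
      ≡⟨ trans (ℤ→ℚ-homo-+ (i ℤ.* X₂) (j ℤ.* X₁)) (cong₂ ℚ._+_ (ℤ→ℚ-homo-* i X₂) (ℤ→ℚ-homo-* j X₁)) ⟩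
    ℤ→ℚ i ℚ.* ℤ→ℚ X₂ ℚ.+ ℤ→ℚ j ℚ.* ℤ→ℚ X₁
      ≡⟨ cong₂ ℚ._+_ (cong₂ ℚ._*_ (sym re≡) X₂≡) (cong₂ ℚ._*_ (sym im≡) X₁≡) ⟩
    re z ℚ.* (two ℚ.* im x) ℚ.+ im z ℚ.* (two ℚ.* re x)
      ≡⟨ solve 4 (λ a b c d → a :* (con two :* d) :+ b :* (con two :* c)
                            := con two :* (a :* d :+ b :* c)) refl (re z) (im z) (re x) (im x) ⟩
    two ℚ.* im (mulE Δ z x) ∎

data IntegralDouble (Δ : ℕ) : ℤ → ℤ → Set where
  both-even : ∀ e f → IntegralDouble Δ (+ 2 ℤ.* e) (+ 2 ℤ.* f)
  both-odd  : ∀ {w} → + Δ ≡ w ℤ.* + 4 ℤ.+ + 1 → ∀ k l →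
              IntegralDouble Δ (k ℤ.* + 2 ℤ.+ + 1) (l ℤ.* + 2 ℤ.+ + 1)

%4≡1⇒≡4w+1 : ∀ {Δ} → Δ % 4 ≡ 1 → + Δ ≡ + (Δ / 4) ℤ.* + 4 ℤ.+ + 1
%4≡1⇒≡4w+1 {Δ} Δ%4≡1 = begin
  + Δ                               ≡⟨ cong +_ (trans (m≡m%n+[m/n]*n Δ 4) (cong (ℕ._+ Δ / 4 ℕ.* 4) Δ%4≡1)) ⟩
  + (1 ℕ.+ Δ / 4 ℕ.* 4)             ≡⟨ ℤP.pos-+ 1 (Δ / 4 ℕ.* 4) ⟩
  + 1 ℤ.+ + (Δ / 4 ℕ.* 4)           ≡⟨ ℤP.+-comm (+ 1) (+ (Δ / 4 ℕ.* 4)) ⟩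
  + (Δ / 4 ℕ.* 4) ℤ.+ + 1           ≡⟨ cong (ℤ._+ + 1) (ℤP.pos-* (Δ / 4) 4) ⟩
  + (Δ / 4) ℤ.* + 4 ℤ.+ + 1         ∎
  where open ≡-Reasoning

halfInt-doubled : ∀ {q k} → q ≡ (k ℤ.* + 2 ℤ.+ + 1) ℚ./ 2 → ℤ→ℚ (k ℤ.* + 2 ℤ.+ + 1) ≡ two ℚ.* q
halfInt-doubled {k = k} q≡ = trans (ℤ→ℚ≡two*/2 (k ℤ.* + 2 ℤ.+ + 1)) (cong (two ℚ.*_) (sym q≡))

doubledCoords : ∀ {Δ x} → InOE Δ x → ∃[ X₁ ] ∃[ X₂ ] DoubledCoords x X₁ X₂ × IntegralDouble Δ X₁ X₂
doubledCoords (inj₁ (e , f , refl)) =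
  + 2 ℤ.* e , + 2 ℤ.* f , doubled (ℤ→ℚ-homo-* (+ 2) e) (ℤ→ℚ-homo-* (+ 2) f) , both-even e f
doubledCoords {Δ} (inj₂ (Δ%4≡1 , (k , re≡) , (l , im≡))) =
  _ , _ , doubled (halfInt-doubled {k = k} re≡) (halfInt-doubled {k = l} im≡) ,
  both-odd {w = + (Δ / 4)} (%4≡1⇒≡4w+1 {Δ} Δ%4≡1) k l

0ℚ≢1ℚ : 0ℚ ≢ 1ℚ
0ℚ≢1ℚ ()

mulE-identityʳ : ∀ Δ z → mulE Δ z (embℤ (+ 1)) ≡ z
mulE-identityʳ Δ z = cong₂ _+_√Δ
  (solve 3 (λ a b D → a :* con 1ℚ :+ D :* (b :* con 0ℚ) := a) refl (re z) (im z) (ℕ→ℚ Δ))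
  (solve 2 (λ a b → a :* con 0ℚ :+ b :* con 1ℚ := b) refl (re z) (im z))

normE-mulE : ∀ Δ z w → normE Δ (mulE Δ z w) ≡ normE Δ z ℚ.* normE Δ w
normE-mulE Δ z w = solve 5 (λ a b c d D →
   (a :* c :+ D :* (b :* d)) :* (a :* c :+ D :* (b :* d)) :- D :* ((a :* d :+ b :* c) :* (a :* d :+ b :* c))
   := (a :* a :- D :* (b :* b)) :* (c :* c :- D :* (d :* d))) refl (re z) (im z) (re w) (im w) (ℕ→ℚ Δ)

normE-one : ∀ Δ → normE Δ (embℤ (+ 1)) ≡ 1ℚ
normE-one Δ = solve 1 (λ D → con 1ℚ :* con 1ℚ :- D :* (con 0ℚ :* con 0ℚ) := con 1ℚ) refl (ℕ→ℚ Δ)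

unit≢0 : ∀ {Δ u} → IsUnit Δ u → u ≢ embℤ (+ 0)
unit≢0 {Δ} (_ , w , _ , 0*w≡1) refl = 0ℚ≢1ℚ (trans
  (solve 3 (λ a b D → con 0ℚ := con 0ℚ :* a :+ D :* (con 0ℚ :* b)) refl (re w) (im w) (ℕ→ℚ Δ))
  (cong re 0*w≡1))

embℤ1≢embℤ0 : embℤ (+ 1) ≢ embℤ (+ 0)
embℤ1≢embℤ0 ()

oddInt-2k+1 : ∀ k → OddInt (k ℤ.* + 2 ℤ.+ + 1)
oddInt-2k+1 k 2∣2k+1 with ℕD.∣1⇒≡1 (∣⇒∣ᵤ 2∣1)
  where
  2∣1 : + 2 ∣ + 1
  2∣1 = ∣m+n∣m⇒∣n (∣ᵤ⇒∣ 2∣2k+1) (∣n⇒∣m*n k (∣-refl {+ 2}))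
... | ()

¬halfInt-ℤ→ℚ : ∀ e → ¬ HalfInt (ℤ→ℚ e)
¬halfInt-ℤ→ℚ e (k , e≡) = oddInt-2k+1 k (∣⇒∣ᵤ (divides e 2k+1≡e*2))
  where
  2k+1≡e*2 : k ℤ.* + 2 ℤ.+ + 1 ≡ e ℤ.* + 2
  2k+1≡e*2 = ℤ→ℚ-injective (trans (halfInt-doubled {k = k} e≡)
    (trans (sym (ℤ→ℚ-homo-* (+ 2) e)) (cong ℤ→ℚ (ℤP.*-comm (+ 2) e))))

halfInt⇒Δ%4≡1 : ∀ {Δ x} → InOE Δ x → HalfInt (re x) → Δ % 4 ≡ 1
halfInt⇒Δ%4≡1 (inj₁ (e , f , refl)) h = ⊥-elim (¬halfInt-ℤ→ℚ e h)
halfInt⇒Δ%4≡1 (inj₂ (Δ%4≡1 , _)) _ = Δ%4≡1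

4∣normE-doubled : ∀ {Δ X₁ X₂} → IntegralDouble Δ X₁ X₂ → + 4 ∣ X₁ ℤ.* X₁ ℤ.- + Δ ℤ.* (X₂ ℤ.* X₂)
4∣normE-doubled {Δ} (both-even e f) = divides (e ℤ.* e ℤ.- + Δ ℤ.* (f ℤ.* f)) (split (+ Δ) e f)
  where
  split : ∀ D e f → + 2 ℤ.* e ℤ.* (+ 2 ℤ.* e) ℤ.- D ℤ.* (+ 2 ℤ.* f ℤ.* (+ 2 ℤ.* f))
                    ≡ (e ℤ.* e ℤ.- D ℤ.* (f ℤ.* f)) ℤ.* + 4
  split = ℤSolver.solve-∀
4∣normE-doubled (both-odd {w} Δ≡4w+1 k l) =
  subst (λ D → + 4 ∣ K ℤ.* K ℤ.- D ℤ.* (L ℤ.* L)) (sym Δ≡4w+1)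
    (divides (k ℤ.* k ℤ.+ k ℤ.- l ℤ.* l ℤ.- l ℤ.- w ℤ.* L ℤ.* L) (split w k l))
  where
  K L : ℤ
  K = k ℤ.* + 2 ℤ.+ + 1
  L = l ℤ.* + 2 ℤ.+ + 1
  split : ∀ w k l → let K = k ℤ.* + 2 ℤ.+ + 1 ; L = l ℤ.* + 2 ℤ.+ + 1 in
    K ℤ.* K ℤ.- (w ℤ.* + 4 ℤ.+ + 1) ℤ.* (L ℤ.* L)
    ≡ (k ℤ.* k ℤ.+ k ℤ.- l ℤ.* l ℤ.- l ℤ.- w ℤ.* L ℤ.* L) ℤ.* + 4
  split = ℤSolver.solve-∀

normE-integral : ∀ {Δ w} → InOE Δ w → ∃[ n ] ℤ→ℚ n ≡ normE Δ w
normE-integral {Δ} {w} w∈𝒪 with doubledCoords {Δ} w∈𝒪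
... | W₁ , W₂ , doubled W₁≡ W₂≡ , parity with 4∣normE-doubled {Δ} parity
...   | divides n N≡n*4 = n , *-cancelˡ-≡ four (begin
  four ℚ.* ℤ→ℚ n
    ≡⟨ trans (sym (ℤ→ℚ-homo-* (+ 4) n)) (cong ℤ→ℚ (trans (ℤP.*-comm (+ 4) n) (sym N≡n*4))) ⟩
  ℤ→ℚ (W₁ ℤ.* W₁ ℤ.- + Δ ℤ.* (W₂ ℤ.* W₂))
    ≡⟨ trans (ℤ→ℚ-homo-− (W₁ ℤ.* W₁) (+ Δ ℤ.* (W₂ ℤ.* W₂)))
         (cong₂ ℚ._-_ (ℤ→ℚ-homo-* W₁ W₁) (trans (ℤ→ℚ-homo-* (+ Δ) (W₂ ℤ.* W₂)) (cong (D ℚ.*_) (ℤ→ℚ-homo-* W₂ W₂)))) ⟩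
  ℤ→ℚ W₁ ℚ.* ℤ→ℚ W₁ ℚ.- D ℚ.* (ℤ→ℚ W₂ ℚ.* ℤ→ℚ W₂)
    ≡⟨ cong₂ (λ a b → a ℚ.* a ℚ.- D ℚ.* (b ℚ.* b)) W₁≡ W₂≡ ⟩
  two ℚ.* re w ℚ.* (two ℚ.* re w) ℚ.- D ℚ.* (two ℚ.* im w ℚ.* (two ℚ.* im w))
    ≡⟨ solve 3 (λ a b D → con two :* a :* (con two :* a) :- D :* (con two :* b :* (con two :* b))
                        := con four :* (a :* a :- D :* (b :* b))) refl (re w) (im w) D ⟩
  four ℚ.* normE Δ w ∎)
  where
  open ≡-Reasoning
  D four : ℚ
  D = ℕ→ℚ Δ
  four = ℤ→ℚ (+ 4)

m*n≡1⇒m≡±1 : ∀ m n → m ℤ.* n ≡ + 1 → m ≡ + 1 ⊎ m ≡ ℤ.- (+ 1)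
m*n≡1⇒m≡±1 m n mn≡1 with ℕP.m*n≡1⇒m≡1 ℤ.∣ m ∣ ℤ.∣ n ∣ (trans (sym (ℤP.abs-* m n)) (cong ℤ.∣_∣ mn≡1))
m*n≡1⇒m≡±1 (+ .1)      n _ | refl = inj₁ refl
m*n≡1⇒m≡±1 -[1+ .0 ]   n _ | refl = inj₂ refl

det≡normE⇒InGL2ℤ : ∀ {Δ u} M → ℤ→ℚ (det M) ≡ normE Δ u → IsUnit Δ u → InGL2ℤ M
det≡normE⇒InGL2ℤ {Δ} {u} M det≡N (_ , w , w∈𝒪 , uw≡1) =
  m*n≡1⇒m≡±1 (det M) N[w] (ℤ→ℚ-injective {det M ℤ.* N[w]} {+ 1} (begin
    ℤ→ℚ (det M ℤ.* N[w])           ≡⟨ ℤ→ℚ-homo-* (det M) N[w] ⟩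
    ℤ→ℚ (det M) ℚ.* ℤ→ℚ N[w]       ≡⟨ cong₂ ℚ._*_ det≡N (proj₂ (normE-integral {Δ} w∈𝒪)) ⟩
    normE Δ u ℚ.* normE Δ w         ≡⟨ sym (normE-mulE Δ u w) ⟩
    normE Δ (mulE Δ u w)            ≡⟨ cong (normE Δ) uw≡1 ⟩
    normE Δ (embℤ (+ 1))            ≡⟨ normE-one Δ ⟩
    ℤ→ℚ (+ 1)                       ∎))
  where
  open ≡-Reasoning
  N[w] : ℤ
  N[w] = proj₁ (normE-integral {Δ} w∈𝒪)

-- Reducing u ≡ a (mod 𝔭) along 𝒪_E → ℤ/p, √Δ ↦ r, after doubling.
congModPrime⇒∣ : ∀ {Δ p r u a U₁ U₂} → + p ∣ r ℤ.* r ℤ.- + Δ → DoubledCoords u U₁ U₂ →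
                 CongModPrime Δ p r u a → + p ∣ U₁ ℤ.+ U₂ ℤ.* r ℤ.- + 2 ℤ.* a
congModPrime⇒∣ {Δ} {p} {r} {u} {a} {U₁} {U₂} p∣r²-Δ dU (x , y , x∈𝒪 , y∈𝒪 , u-a≡)
  with doubledCoords {Δ} x∈𝒪 | doubledCoords {Δ} y∈𝒪
... | X₁ , X₂ , dX , _ | Y₁ , Y₂ , dY , _ =
  subst (+ p ∣_) (sym U-reduction)
    (∣m∣n⇒∣m-n (∣m⇒∣m*n (X₁ ℤ.+ r ℤ.* X₂) (∣-refl {+ p})) (∣m⇒∣m*n Y₂ p∣r²-Δ))
  where
  open ≡-Reasoning
  A B : ℤ
  A = (+ p ℤ.* X₁ ℤ.+ + Δ ℤ.* (+ 0 ℤ.* X₂)) ℤ.+ (ℤ.- r ℤ.* Y₁ ℤ.+ + Δ ℤ.* (+ 1 ℤ.* Y₂))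
  B = (+ p ℤ.* X₂ ℤ.+ + 0 ℤ.* X₁) ℤ.+ (ℤ.- r ℤ.* Y₂ ℤ.+ + 1 ℤ.* Y₁)
  re-√Δ-r : re (√Δ -E embℤ r) ≡ ℤ→ℚ (ℤ.- r)
  re-√Δ-r = trans (ℚP.+-identityˡ (ℚ.- ℤ→ℚ r)) (sym (ℤ→ℚ-homo‿- r))
  lhs : DoubledCoords (u -E embℤ a) (U₁ ℤ.- + 2 ℤ.* a) (U₂ ℤ.- + 0)
  lhs = doubled--E dU (doubled-embℤ a)
  rhs : DoubledCoords (u -E embℤ a) A B
  rhs = subst (λ z → DoubledCoords z A B) (sym u-a≡)
    (doubled-+E (doubled-mulE {Δ} {i = + p} {+ 0} refl refl dX) (doubled-mulE {Δ} {i = ℤ.- r} {+ 1} re-√Δ-r refl dY))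
  split : ∀ P D r X₁ X₂ Y₁ Y₂ →
    let A = (P ℤ.* X₁ ℤ.+ D ℤ.* (+ 0 ℤ.* X₂)) ℤ.+ (ℤ.- r ℤ.* Y₁ ℤ.+ D ℤ.* (+ 1 ℤ.* Y₂))
        B = (P ℤ.* X₂ ℤ.+ + 0 ℤ.* X₁) ℤ.+ (ℤ.- r ℤ.* Y₂ ℤ.+ + 1 ℤ.* Y₁)
    in A ℤ.+ B ℤ.* r ≡ P ℤ.* (X₁ ℤ.+ r ℤ.* X₂) ℤ.- (r ℤ.* r ℤ.- D) ℤ.* Y₂
  split = ℤSolver.solve-∀
  U-reduction : U₁ ℤ.+ U₂ ℤ.* r ℤ.- + 2 ℤ.* a ≡ + p ℤ.* (X₁ ℤ.+ r ℤ.* X₂) ℤ.- (r ℤ.* r ℤ.- + Δ) ℤ.* Y₂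
  U-reduction = begin
    U₁ ℤ.+ U₂ ℤ.* r ℤ.- + 2 ℤ.* a             ≡⟨ ℤSolver.solve (U₁ ∷ U₂ ∷ r ∷ a ∷ []) ⟩
    (U₁ ℤ.- + 2 ℤ.* a) ℤ.+ (U₂ ℤ.- + 0) ℤ.* r ≡⟨ cong₂ (λ s t → s ℤ.+ t ℤ.* r) (proj₁ (doubled-unique lhs rhs)) (proj₂ (doubled-unique lhs rhs)) ⟩
    A ℤ.+ B ℤ.* r                              ≡⟨ split (+ p) (+ Δ) r X₁ X₂ Y₁ Y₂ ⟩
    + p ℤ.* (X₁ ℤ.+ r ℤ.* X₂) ℤ.- (r ℤ.* r ℤ.- + Δ) ℤ.* Y₂ ∎

β : ℚ → ℚ → E
β c h = (c ℚ.* h) + h √Δ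

actℚ : ℕ → ℚ → ℚ → ℚ → ℚ → E × E → E × E
actℚ Δ q₁₁ q₁₂ q₂₁ q₂₂ (x , y) =
  (mulE Δ (q₁₁ + 0ℚ √Δ) x +E mulE Δ (q₁₂ + 0ℚ √Δ) y) ,
  (mulE Δ (q₂₁ + 0ℚ √Δ) x +E mulE Δ (q₂₂ + 0ℚ √Δ) y)

-- Polynomial counterparts of the operations of E, so that the ring solver can check
-- identities in E one coordinate at a time.
private
  PE : ℕ → Set
  PE n = Polynomial n × Polynomial n

  _⊕ₚ_ : ∀ {n} → PE n → PE n → PE n
  (a , b) ⊕ₚ (c , d) = (a :+ c) , (b :+ d)

  mulₚ : ∀ {n} → Polynomial n → PE n → PE n → PE n
  mulₚ D (a , b) (c , d) = (a :* c :+ D :* (b :* d)) , (a :* d :+ b :* c)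

  scalarₚ : ∀ {n} → Polynomial n → PE n
  scalarₚ q = q , con 0ℚ

  oneₚ : ∀ {n} → PE n
  oneₚ = con 1ℚ , con 0ℚ

actℚ-β : ∀ Δ {c h e f q₁₁ q₁₂ q₂₁ q₂₂} → q₂₁ ℚ.* h ≡ f →
  q₁₁ ≡ e ℚ.+ f ℚ.* c → q₁₂ ≡ f ℚ.* (ℕ→ℚ Δ ℚ.- c ℚ.* c) ℚ.* h → q₂₂ ≡ e ℚ.- f ℚ.* c →
  actℚ Δ q₁₁ q₁₂ q₂₁ q₂₂ (β c h , embℤ (+ 1)) ≡ (mulE Δ (β c h) (e + f √Δ) , e + f √Δ)
actℚ-β Δ {c} {h} {e} {q₂₁ = q} refl refl refl refl = cong₂ _,_
  (cong₂ _+_√Δ (solve 5 (λ e q c h D → proj₁ (image₁ e q c h D) := proj₁ (eigen e q c h D)) refl e q c h (ℕ→ℚ Δ))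
               (solve 5 (λ e q c h D → proj₂ (image₁ e q c h D) := proj₂ (eigen e q c h D)) refl e q c h (ℕ→ℚ Δ)))
  (cong₂ _+_√Δ (solve 5 (λ e q c h D → proj₁ (image₂ e q c h D) := e) refl e q c h (ℕ→ℚ Δ))
               (solve 5 (λ e q c h D → proj₂ (image₂ e q c h D) := q :* h) refl e q c h (ℕ→ℚ Δ)))
  where
  βₚ : Polynomial 5 → Polynomial 5 → PE 5
  βₚ c h = c :* h , h
  image₁ image₂ eigen : (e q c h D : Polynomial 5) → PE 5
  image₁ e q c h D = mulₚ D (scalarₚ (e :+ q :* h :* c)) (βₚ c h) ⊕ₚ mulₚ D (scalarₚ (q :* h :* (D :- c :* c) :* h)) oneₚ
  image₂ e q c h D = mulₚ D (scalarₚ q) (βₚ c h) ⊕ₚ mulₚ D (scalarₚ (e :- q :* h :* c)) oneₚ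
  eigen e q c h D = mulₚ D (βₚ c h) (e , q :* h)

detℚ : ∀ Δ {c h e f q₁₁ q₁₂ q₂₁ q₂₂} → q₂₁ ℚ.* h ≡ f →
  q₁₁ ≡ e ℚ.+ f ℚ.* c → q₁₂ ≡ f ℚ.* (ℕ→ℚ Δ ℚ.- c ℚ.* c) ℚ.* h → q₂₂ ≡ e ℚ.- f ℚ.* c →
  q₁₁ ℚ.* q₂₂ ℚ.- q₁₂ ℚ.* q₂₁ ≡ e ℚ.* e ℚ.- ℕ→ℚ Δ ℚ.* (f ℚ.* f)
detℚ Δ {c} {h} {e} {q₂₁ = q} refl refl refl refl = solve 5 (λ e q c h D →
  (e :+ q :* h :* c) :* (e :- q :* h :* c) :- q :* h :* (D :- c :* c) :* h :* q
  := e :* e :- D :* (q :* h :* (q :* h))) refl e q c h (ℕ→ℚ Δ)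

-- The matrix of multiplication by u in the ℚ-basis (β c h , 1) of E.
record MultiplicationMatrix (Δ : ℕ) (c h : ℚ) (u : E) (M : Mat2) : Set where
  field
    m₂₁-cast : ℤ→ℚ (m21 M) ℚ.* h ≡ im u
    m₁₁-cast : ℤ→ℚ (m11 M) ≡ re u ℚ.+ im u ℚ.* c
    m₁₂-cast : ℤ→ℚ (m12 M) ≡ im u ℚ.* (ℕ→ℚ Δ ℚ.- c ℚ.* c) ℚ.* h
    m₂₂-cast : ℤ→ℚ (m22 M) ≡ re u ℚ.- im u ℚ.* c

  act-β : act Δ M (β c h , embℤ (+ 1)) ≡ (mulE Δ (β c h) u , u)
  act-β = actℚ-β Δ {c} {h} {re u} {im u} {ℤ→ℚ (m11 M)} {ℤ→ℚ (m12 M)} {ℤ→ℚ (m21 M)} {ℤ→ℚ (m22 M)}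
    m₂₁-cast m₁₁-cast m₁₂-cast m₂₂-cast

  det≡normE : ℤ→ℚ (det M) ≡ normE Δ u
  det≡normE = begin
    ℤ→ℚ (m11 M ℤ.* m22 M ℤ.- m12 M ℤ.* m21 M)
      ≡⟨ trans (ℤ→ℚ-homo-− (m11 M ℤ.* m22 M) (m12 M ℤ.* m21 M))
           (cong₂ ℚ._-_ (ℤ→ℚ-homo-* (m11 M) (m22 M)) (ℤ→ℚ-homo-* (m12 M) (m21 M))) ⟩
    ℤ→ℚ (m11 M) ℚ.* ℤ→ℚ (m22 M) ℚ.- ℤ→ℚ (m12 M) ℚ.* ℤ→ℚ (m21 M)
      ≡⟨ detℚ Δ {c} {h} {re u} {im u} {ℤ→ℚ (m11 M)} {ℤ→ℚ (m12 M)} {ℤ→ℚ (m21 M)} {ℤ→ℚ (m22 M)}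
           m₂₁-cast m₁₁-cast m₁₂-cast m₂₂-cast ⟩
    normE Δ u ∎
    where open ≡-Reasoning

eigenvector⇒betaUnital : ∀ {Δ β M μ} → act Δ M (β , embℤ (+ 1)) ≡ (mulE Δ β μ , μ) →
                         μ ≢ embℤ (+ 0) → BetaUnital Δ β M
eigenvector⇒betaUnital {Δ} {β} {M} {μ} act≡ μ≢0 =
  subst (λ P → SameP1 Δ P (β , embℤ (+ 1))) (sym act≡)
    ((λ (_ , μ≡0) → μ≢0 μ≡0) , (λ (_ , 1≡0) → embℤ1≢embℤ0 1≡0) , mulE-identityʳ Δ (mulE Δ β μ))

1/[2p] : (p : ℕ) .{{_ : ℕ.NonZero p}} → ℚ
1/[2p] p = ℚ.1/ mkℚ (+ (2 ℕ.* p)) 0 (Cop.sym (Cop.1-coprimeTo (2 ℕ.* p)))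
  where instance _ = ℕP.m*n≢0 2 p

2p*1/[2p]≡1 : ∀ p .{{_ : ℕ.NonZero p}} → two ℚ.* ℤ→ℚ (+ p) ℚ.* 1/[2p] p ≡ 1ℚ
2p*1/[2p]≡1 p = trans (cong (ℚ._* 1/[2p] p) two*p≡2p) (ℚP.*-inverseʳ 2p)
  where
  instance _ = ℕP.m*n≢0 2 p
  2p : ℚ
  2p = mkℚ (+ (2 ℕ.* p)) 0 (Cop.sym (Cop.1-coprimeTo (2 ℕ.* p)))
  two*p≡2p : two ℚ.* ℤ→ℚ (+ p) ≡ 2p
  two*p≡2p = trans (sym (ℤ→ℚ-homo-* (+ 2) (+ p)))
    (trans (cong ℤ→ℚ (sym (ℤP.pos-* 2 p))) (ℤ→ℚ-mkℚ (+ (2 ℕ.* p))))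

β₀ : (p : ℕ) .{{_ : ℕ.NonZero p}} → ℤ → E
β₀ p c = β (ℤ→ℚ c) (1/[2p] p)

β₀-notRational : ∀ p .{{_ : ℕ.NonZero p}} c → NotRational (β₀ p c)
β₀-notRational p c h≡0 = 0ℚ≢1ℚ (begin
  0ℚ                                     ≡⟨ sym (ℚP.*-zeroʳ (two ℚ.* ℤ→ℚ (+ p))) ⟩
  two ℚ.* ℤ→ℚ (+ p) ℚ.* 0ℚ               ≡⟨ cong (two ℚ.* ℤ→ℚ (+ p) ℚ.*_) (sym h≡0) ⟩
  two ℚ.* ℤ→ℚ (+ p) ℚ.* 1/[2p] p          ≡⟨ 2p*1/[2p]≡1 p ⟩
  1ℚ                                     ∎)
  where open ≡-Reasoning

mulMatrix : ℕ → ℤ → ℤ → ℤ → ℤ → Mat2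
mulMatrix p c n₁₁ n₁₂ U₂ = mat n₁₁ n₁₂ (+ p ℤ.* U₂) (n₁₁ ℤ.- U₂ ℤ.* c)

halved-cast : ∀ {u U₁ U₂} c n → DoubledCoords u U₁ U₂ → U₁ ℤ.+ U₂ ℤ.* c ≡ n ℤ.* + 2 →
              ℤ→ℚ n ≡ re u ℚ.+ im u ℚ.* ℤ→ℚ c
halved-cast {u} {U₁} {U₂} c n (doubled U₁≡ U₂≡) U≡2n = *-cancelˡ-≡ two (begin
  two ℚ.* ℤ→ℚ n                     ≡⟨ trans (sym (ℤ→ℚ-homo-* (+ 2) n)) (cong ℤ→ℚ (trans (ℤP.*-comm (+ 2) n) (sym U≡2n))) ⟩
  ℤ→ℚ (U₁ ℤ.+ U₂ ℤ.* c)             ≡⟨ trans (ℤ→ℚ-homo-+ U₁ (U₂ ℤ.* c)) (cong (ℤ→ℚ U₁ ℚ.+_) (ℤ→ℚ-homo-* U₂ c)) ⟩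
  ℤ→ℚ U₁ ℚ.+ ℤ→ℚ U₂ ℚ.* ℤ→ℚ c       ≡⟨ cong₂ (λ a b → a ℚ.+ b ℚ.* ℤ→ℚ c) U₁≡ U₂≡ ⟩
  two ℚ.* re u ℚ.+ two ℚ.* im u ℚ.* ℤ→ℚ c
    ≡⟨ solve 3 (λ e f c → con two :* e :+ con two :* f :* c := con two :* (e :+ f :* c)) refl (re u) (im u) (ℤ→ℚ c) ⟩
  two ℚ.* (re u ℚ.+ im u ℚ.* ℤ→ℚ c) ∎)
  where open ≡-Reasoning

halved-conjugate-cast : ∀ {u U₁ U₂} c n → DoubledCoords u U₁ U₂ → U₁ ℤ.+ U₂ ℤ.* c ≡ n ℤ.* + 2 →
                        ℤ→ℚ (n ℤ.- U₂ ℤ.* c) ≡ re u ℚ.- im u ℚ.* ℤ→ℚ c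
halved-conjugate-cast {u} {U₁} {U₂} c n dU U≡2n = begin
  ℤ→ℚ (n ℤ.- U₂ ℤ.* c)
    ≡⟨ trans (ℤ→ℚ-homo-− n (U₂ ℤ.* c)) (cong (λ x → ℤ→ℚ n ℚ.- x) (ℤ→ℚ-homo-* U₂ c)) ⟩
  ℤ→ℚ n ℚ.- ℤ→ℚ U₂ ℚ.* ℤ→ℚ c
    ≡⟨ cong₂ (λ a b → a ℚ.- b ℚ.* ℤ→ℚ c) (halved-cast c n dU U≡2n) (DoubledCoords.im-doubled dU) ⟩
  re u ℚ.+ im u ℚ.* ℤ→ℚ c ℚ.- two ℚ.* im u ℚ.* ℤ→ℚ c
    ≡⟨ solve 3 (λ e f c → e :+ f :* c :- con two :* f :* c := e :- f :* c) refl (re u) (im u) (ℤ→ℚ c) ⟩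
  re u ℚ.- im u ℚ.* ℤ→ℚ c ∎
  where open ≡-Reasoning

p*U₂-cast : ∀ p .{{_ : ℕ.NonZero p}} {u U₁ U₂} → DoubledCoords u U₁ U₂ →
            ℤ→ℚ (+ p ℤ.* U₂) ℚ.* 1/[2p] p ≡ im u
p*U₂-cast p {u} {U₁} {U₂} (doubled _ U₂≡) = begin
  ℤ→ℚ (+ p ℤ.* U₂) ℚ.* h          ≡⟨ cong (ℚ._* h) (trans (ℤ→ℚ-homo-* (+ p) U₂) (cong (P ℚ.*_) U₂≡)) ⟩
  P ℚ.* (two ℚ.* im u) ℚ.* h      ≡⟨ solve 3 (λ P f h → P :* (con two :* f) :* h := con two :* P :* h :* f) refl P (im u) h ⟩
  two ℚ.* P ℚ.* h ℚ.* im u        ≡⟨ cong (ℚ._* im u) (2p*1/[2p]≡1 p) ⟩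
  1ℚ ℚ.* im u                     ≡⟨ ℚP.*-identityˡ (im u) ⟩
  im u                            ∎
  where
  open ≡-Reasoning
  P h : ℚ
  P = ℤ→ℚ (+ p)
  h = 1/[2p] p

quartered-cast : ∀ {Δ} p .{{_ : ℕ.NonZero p}} {u U₁ U₂} c n → DoubledCoords u U₁ U₂ →
  U₂ ℤ.* (+ Δ ℤ.- c ℤ.* c) ≡ n ℤ.* (+ 4 ℤ.* + p) →
  ℤ→ℚ n ≡ im u ℚ.* (ℕ→ℚ Δ ℚ.- ℤ→ℚ c ℚ.* ℤ→ℚ c) ℚ.* 1/[2p] p
quartered-cast {Δ} p {u} {U₁} {U₂} c n (doubled _ U₂≡) U₂[Δ-c²]≡4pn = begin
  ℤ→ℚ n                           ≡⟨ sym (ℚP.*-identityˡ (ℤ→ℚ n)) ⟩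
  1ℚ ℚ.* ℤ→ℚ n                    ≡⟨ cong (ℚ._* ℤ→ℚ n) (sym (2p*1/[2p]≡1 p)) ⟩
  two ℚ.* P ℚ.* h ℚ.* ℤ→ℚ n       ≡⟨ solve 3 (λ P h n → con two :* P :* h :* n := con two :* P :* n :* h) refl P h (ℤ→ℚ n) ⟩
  two ℚ.* P ℚ.* ℤ→ℚ n ℚ.* h       ≡⟨ cong (ℚ._* h) 2Pn≡f[D-c²] ⟩
  f ℚ.* (D ℚ.- c' ℚ.* c') ℚ.* h   ∎
  where
  open ≡-Reasoning
  f c' h P D : ℚ
  f = im u
  c' = ℤ→ℚ c
  h = 1/[2p] p
  P = ℤ→ℚ (+ p)
  D = ℕ→ℚ Δ
  2Pn≡f[D-c²] : two ℚ.* P ℚ.* ℤ→ℚ n ≡ f ℚ.* (D ℚ.- c' ℚ.* c')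
  2Pn≡f[D-c²] = *-cancelˡ-≡ two (begin
    two ℚ.* (two ℚ.* P ℚ.* ℤ→ℚ n)
      ≡⟨ solve 2 (λ P n → con two :* (con two :* P :* n) := n :* (con (ℤ→ℚ (+ 4)) :* P)) refl P (ℤ→ℚ n) ⟩
    ℤ→ℚ n ℚ.* (ℤ→ℚ (+ 4) ℚ.* P)
      ≡⟨ sym (trans (ℤ→ℚ-homo-* n (+ 4 ℤ.* + p)) (cong (ℤ→ℚ n ℚ.*_) (ℤ→ℚ-homo-* (+ 4) (+ p)))) ⟩
    ℤ→ℚ (n ℤ.* (+ 4 ℤ.* + p))
      ≡⟨ cong ℤ→ℚ (sym U₂[Δ-c²]≡4pn) ⟩
    ℤ→ℚ (U₂ ℤ.* (+ Δ ℤ.- c ℤ.* c))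
      ≡⟨ trans (ℤ→ℚ-homo-* U₂ (+ Δ ℤ.- c ℤ.* c))
           (cong (ℤ→ℚ U₂ ℚ.*_) (trans (ℤ→ℚ-homo-− (+ Δ) (c ℤ.* c)) (cong (λ x → D ℚ.- x) (ℤ→ℚ-homo-* c c)))) ⟩
    ℤ→ℚ U₂ ℚ.* (D ℚ.- c' ℚ.* c')
      ≡⟨ cong (ℚ._* (D ℚ.- c' ℚ.* c')) U₂≡ ⟩
    two ℚ.* f ℚ.* (D ℚ.- c' ℚ.* c')
      ≡⟨ ℚP.*-assoc two f (D ℚ.- c' ℚ.* c') ⟩
    two ℚ.* (f ℚ.* (D ℚ.- c' ℚ.* c')) ∎)

mulMatrix-multiplication : ∀ {Δ p} .{{_ : ℕ.NonZero p}} {c u U₁ U₂ n₁₁ n₁₂} → DoubledCoords u U₁ U₂ →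
  U₁ ℤ.+ U₂ ℤ.* c ≡ n₁₁ ℤ.* + 2 → U₂ ℤ.* (+ Δ ℤ.- c ℤ.* c) ≡ n₁₂ ℤ.* (+ 4 ℤ.* + p) →
  MultiplicationMatrix Δ (ℤ→ℚ c) (1/[2p] p) u (mulMatrix p c n₁₁ n₁₂ U₂)
mulMatrix-multiplication {Δ} {p} {c} {n₁₁ = n₁₁} {n₁₂} dU U≡2n₁₁ U₂[Δ-c²]≡4pn₁₂ = record
  { m₂₁-cast = p*U₂-cast p dU
  ; m₁₁-cast = halved-cast c n₁₁ dU U≡2n₁₁
  ; m₁₂-cast = quartered-cast {Δ} p c n₁₂ dU U₂[Δ-c²]≡4pn₁₂
  ; m₂₂-cast = halved-conjugate-cast c n₁₁ dU U≡2n₁₁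
  }

mulMatrix-entries-integral : ∀ {Δ P c U₁ U₂} → SqrtMod (+ Δ) P c → IntegralDouble Δ U₁ U₂ →
  (+ 2 ∣ U₁ ℤ.+ U₂ ℤ.* c) × (+ 4 ℤ.* P ∣ U₂ ℤ.* (+ Δ ℤ.- c ℤ.* c))
mulMatrix-entries-integral {Δ} {P} {c} sqrt (both-even e f) =
  divides (e ℤ.+ f ℤ.* c) (split₁ e f c) ,
  divides (f ℤ.* K) (trans (cong (+ 2 ℤ.* f ℤ.*_) Δ-c²≡K*2P) (split₂ f K P))
  where
  K : ℤ
  K = quotient (SqrtMod.mod-2P sqrt)
  Δ-c²≡K*2P : + Δ ℤ.- c ℤ.* c ≡ K ℤ.* (+ 2 ℤ.* P)
  Δ-c²≡K*2P = _∣_.equality (SqrtMod.mod-2P sqrt)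
  split₁ : ∀ e f c → + 2 ℤ.* e ℤ.+ + 2 ℤ.* f ℤ.* c ≡ (e ℤ.+ f ℤ.* c) ℤ.* + 2
  split₁ = ℤSolver.solve-∀
  split₂ : ∀ f K P → + 2 ℤ.* f ℤ.* (K ℤ.* (+ 2 ℤ.* P)) ≡ f ℤ.* K ℤ.* (+ 4 ℤ.* P)
  split₂ = ℤSolver.solve-∀
mulMatrix-entries-integral {Δ} {P} {c} sqrt (both-odd {w} Δ≡4w+1 k l) =
  subst (λ c → + 2 ∣ U₁ ℤ.+ U₂ ℤ.* c) (sym c≡2j+1)
    (divides (k ℤ.+ l ℤ.* j ℤ.* + 2 ℤ.+ l ℤ.+ j ℤ.+ + 1) (split k l j)) ,
  ∣n⇒∣m*n U₂ (proj₂ (SqrtMod.mod-4P sqrt w Δ≡4w+1))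
  where
  U₁ U₂ j : ℤ
  U₁ = k ℤ.* + 2 ℤ.+ + 1
  U₂ = l ℤ.* + 2 ℤ.+ + 1
  j = proj₁ (proj₁ (SqrtMod.mod-4P sqrt w Δ≡4w+1))
  c≡2j+1 : c ≡ j ℤ.* + 2 ℤ.+ + 1
  c≡2j+1 = proj₂ (proj₁ (SqrtMod.mod-4P sqrt w Δ≡4w+1))
  split : ∀ k l j → (k ℤ.* + 2 ℤ.+ + 1) ℤ.+ (l ℤ.* + 2 ℤ.+ + 1) ℤ.* (j ℤ.* + 2 ℤ.+ + 1)
                    ≡ (k ℤ.+ l ℤ.* j ℤ.* + 2 ℤ.+ l ℤ.+ j ℤ.+ + 1) ℤ.* + 2
  split = ℤSolver.solve-∀

-- 2n = U₁ + U₂c ≡ U₁ + U₂r ≡ 2a (mod p), and 2 is invertible modulo the odd p.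
halved≡-mod-p : ∀ {p Q U₁ U₂ c r n a} → + p ≡ Q ℤ.* + 2 ℤ.+ + 1 → U₁ ℤ.+ U₂ ℤ.* c ≡ n ℤ.* + 2 →
  + p ∣ U₁ ℤ.+ U₂ ℤ.* r ℤ.- + 2 ℤ.* a → + p ∣ c ℤ.- r → + p ∣ n ℤ.- a
halved≡-mod-p {p} {Q} {U₁} {U₂} {c} {r} {n} {a} p≡2Q+1 U≡2n p∣U[r]-2a p∣c-r =
  ∣*-cancel-invertible {+ p} {+ 2} {n ℤ.- a} (Q ℤ.+ + 1) (+ 1) 2[Q+1]≡1+p
    (subst (+ p ∣_) shift (∣m∣n⇒∣m+n p∣U[r]-2a (∣n⇒∣m*n U₂ p∣c-r)))
  where
  open ≡-Reasoning
  shift : U₁ ℤ.+ U₂ ℤ.* r ℤ.- + 2 ℤ.* a ℤ.+ U₂ ℤ.* (c ℤ.- r) ≡ + 2 ℤ.* (n ℤ.- a)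
  shift = begin
    U₁ ℤ.+ U₂ ℤ.* r ℤ.- + 2 ℤ.* a ℤ.+ U₂ ℤ.* (c ℤ.- r) ≡⟨ ℤSolver.solve (U₁ ∷ U₂ ∷ r ∷ a ∷ c ∷ []) ⟩
    U₁ ℤ.+ U₂ ℤ.* c ℤ.- + 2 ℤ.* a                     ≡⟨ cong (ℤ._- + 2 ℤ.* a) U≡2n ⟩
    n ℤ.* + 2 ℤ.- + 2 ℤ.* a                           ≡⟨ ℤSolver.solve (n ∷ a ∷ []) ⟩
    + 2 ℤ.* (n ℤ.- a)                                 ∎
  2[Q+1]≡1+p : + 2 ℤ.* (Q ℤ.+ + 1) ≡ + 1 ℤ.+ + p ℤ.* + 1
  2[Q+1]≡1+p = begin
    + 2 ℤ.* (Q ℤ.+ + 1)                 ≡⟨ ℤSolver.solve (Q ∷ []) ⟩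
    + 1 ℤ.+ (Q ℤ.* + 2 ℤ.+ + 1) ℤ.* + 1 ≡⟨ cong (λ x → + 1 ℤ.+ x ℤ.* + 1) (sym p≡2Q+1) ⟩
    + 1 ℤ.+ + p ℤ.* + 1                 ∎

halfInt⇒sqrtMod-odd : ∀ {Δ P c x} → SqrtMod (+ Δ) P c → InOE Δ x → HalfInt (re x) → OddInt c
halfInt⇒sqrtMod-odd {Δ} {P} {c} sqrt x∈𝒪 half-re = subst OddInt (sym (proj₂ c-odd)) (oddInt-2k+1 (proj₁ c-odd))
  where
  c-odd : ∃[ j ] c ≡ j ℤ.* + 2 ℤ.+ + 1
  c-odd = proj₁ (SqrtMod.mod-4P sqrt (+ (Δ / 4)) (%4≡1⇒≡4w+1 {Δ} (halfInt⇒Δ%4≡1 {Δ} x∈𝒪 half-re)))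

UnitalMatrixFor : ℕ → ℕ → E → ℤ → E → Set
UnitalMatrixFor Δ p β a u =
  ∃[ M ] InGL2ℤ M × BetaUnital Δ β M ×
    (∃[ s ] ∃[ t ] m11 M ≡ a ℤ.+ + p ℤ.* s × m21 M ≡ + p ℤ.* t ×
      ℤ→ℚ (det M) ≡ normE Δ u ×
      ℤ→ℚ t ≡ ℤ→ℚ (+ 2) ℚ.* im u ×
      (∃[ x₀ ] ℤ→ℚ (a ℤ.+ + p ℤ.* s) ≡ ℤ→ℚ x₀ ℚ.* im u ℚ.+ re u ×
        (HalfInt (re u) × HalfInt (im u) → OddInt x₀)))

unitalMatrix : ∀ {Δ p r c a u U₁ U₂} .{{_ : ℕ.NonZero p}} Q → + p ≡ Q ℤ.* + 2 ℤ.+ + 1 →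
  + p ∣ r ℤ.* r ℤ.- + Δ → SqrtMod (+ Δ) (+ p) c → + p ∣ c ℤ.- r →
  DoubledCoords u U₁ U₂ → IntegralDouble Δ U₁ U₂ →
  IsUnit Δ u → CongModPrime Δ p r u a → UnitalMatrixFor Δ p (β₀ p c) a u
unitalMatrix {Δ} {p} {r} {c} {a} {u} {U₁} {U₂} Q p≡2Q+1 p∣r²-Δ sqrt p∣c-r dU parity u-unit u≡a =
  M , det≡normE⇒InGL2ℤ {Δ} {u} M det≡normE u-unit ,
  eigenvector⇒betaUnital {Δ} {β₀ p c} {M} {u} act-β (unit≢0 {Δ} {u} u-unit) ,
  s , U₂ , n₁₁≡a+ps , refl , det≡normE , DoubledCoords.im-doubled dU ,
  c , x₀-formula , (λ (half-re , _) → halfInt⇒sqrtMod-odd sqrt (proj₁ u-unit) half-re)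
  where
  2∣U₁+U₂c : + 2 ∣ U₁ ℤ.+ U₂ ℤ.* c
  2∣U₁+U₂c = proj₁ (mulMatrix-entries-integral sqrt parity)
  4p∣U₂[Δ-c²] : + 4 ℤ.* + p ∣ U₂ ℤ.* (+ Δ ℤ.- c ℤ.* c)
  4p∣U₂[Δ-c²] = proj₂ (mulMatrix-entries-integral sqrt parity)
  n₁₁ n₁₂ : ℤ
  n₁₁ = quotient 2∣U₁+U₂c
  n₁₂ = quotient 4p∣U₂[Δ-c²]
  M : Mat2
  M = mulMatrix p c n₁₁ n₁₂ U₂
  open MultiplicationMatrix {Δ} {ℤ→ℚ c} {1/[2p] p} {u} {M}
    (mulMatrix-multiplication {Δ} {p} {c} {u} {U₁} {U₂} {n₁₁} {n₁₂} dU
      (_∣_.equality 2∣U₁+U₂c) (_∣_.equality 4p∣U₂[Δ-c²]))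
  p∣n₁₁-a : + p ∣ n₁₁ ℤ.- a
  p∣n₁₁-a = halved≡-mod-p {p} {Q} {U₁} {U₂} {c} {r} {n₁₁} {a} p≡2Q+1 (_∣_.equality 2∣U₁+U₂c)
    (congModPrime⇒∣ {Δ} {p} {r} {u} {a} {U₁} {U₂} p∣r²-Δ dU u≡a) p∣c-r
  s : ℤ
  s = quotient p∣n₁₁-a
  n₁₁≡a+ps : n₁₁ ≡ a ℤ.+ + p ℤ.* s
  n₁₁≡a+ps = ∣m-n⇒m≡n+k*q {+ p} {n₁₁} {a} p∣n₁₁-a
  x₀-formula : ℤ→ℚ (a ℤ.+ + p ℤ.* s) ≡ ℤ→ℚ c ℚ.* im u ℚ.+ re u
  x₀-formula = trans (cong ℤ→ℚ (sym n₁₁≡a+ps)) (trans m₁₁-cast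
    (solve 3 (λ e f c → e :+ f :* c := c :* f :+ e) refl (re u) (im u) (ℤ→ℚ c)))

theorem6p3 : (Δ : ℕ) → 2 ℕ.≤ Δ → SquareFree Δ →
    (p : ℕ) → Prime p → ¬ (2 ℕD.∣ p) →
    -- (p) = 𝔭𝔭' splits; 𝔭 = (p, √Δ - r)
    (r : ℤ) → (+ p) ℤD.∣ (r ℤ.* r ℤ.- + Δ) → ¬ ((+ p) ℤD.∣ (+ Δ)) →
    Σ E λ β → NotRational β ×
      ((a : ℤ) → ¬ ((+ p) ℤD.∣ a) →
        (∃[ u ] IsUnit Δ u × CongModPrime Δ p r u a) →
        ∃[ M ] InGL2ℤ M × BetaUnital Δ β M ×
          (∃[ s ] ∃[ t ] m11 M ≡ a ℤ.+ + p ℤ.* s × m21 M ≡ + p ℤ.* t))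
      ×
      ((a : ℤ) → ¬ ((+ p) ℤD.∣ a) →
        (u : E) → IsUnit Δ u → CongModPrime Δ p r u a →
        ∃[ M ] InGL2ℤ M × BetaUnital Δ β M ×
          (∃[ s ] ∃[ t ] m11 M ≡ a ℤ.+ + p ℤ.* s × m21 M ≡ + p ℤ.* t ×
            ℤ→ℚ (det M) ≡ normE Δ u ×
            ℤ→ℚ t ≡ ℤ→ℚ (+ 2) ℚ.* im u ×
            (∃[ x₀ ] ℤ→ℚ (a ℤ.+ + p ℤ.* s) ≡ ℤ→ℚ x₀ ℚ.* im u ℚ.+ re u ×
              (HalfInt (re u) × HalfInt (im u) → OddInt x₀))))
theorem6p3 Δ _ _ p p-prime p-odd r p∣ᵤr²-Δ _ =
  β₀ p c , β₀-notRational p c ,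
  (λ a _ (u , u-unit , u≡a) → let (M , M-GL₂ , M-unital , s , t , m₁₁≡ , m₂₁≡ , _) = matrix a u u-unit u≡a
                              in M , M-GL₂ , M-unital , s , t , m₁₁≡ , m₂₁≡) ,
  (λ a _ → matrix a)
  where
  instance
    p≢0 : ℕ.NonZero p
    p≢0 = prime⇒nonZero p-prime
  Q c : ℤ
  Q = + (p / 2)
  c = liftRoot (+ p) (+ Δ) r
  p∣r²-Δ : + p ∣ r ℤ.* r ℤ.- + Δ
  p∣r²-Δ = ∣ᵤ⇒∣ p∣ᵤr²-Δ
  matrix : ∀ a u → IsUnit Δ u → CongModPrime Δ p r u a → UnitalMatrixFor Δ p (β₀ p c) a u
  matrix a u u-unit =
    let (U₁ , U₂ , dU , parity) = doubledCoords {Δ} (proj₁ u-unit)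
    in unitalMatrix {Δ} {p} {r} {c} {a} {u} {U₁} {U₂} Q (odd⇒≡2Q+1 p-odd) p∣r²-Δ
         (liftRoot-sqrtMod {+ p} {+ Δ} {r} Q (odd⇒≡2Q+1 p-odd) p∣r²-Δ) (liftRoot≡r (+ p) (+ Δ) r)
         dU parity u-unit
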